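{- Let $k$ be a positive integer, let $p\geq 2$ be an integer, and let $H$ be an equipartite tree with $2k$ vertices such that $t(n,H)\leq (k-1)n$ for all $n$. Then $t_p(n,H)=(k-1)n^p+o(n^p)$ as $n\to\infty$.
   Context: All graphs are finite, simple, undirected. A connected bipartite graph is equipartite if the two vertex classes of its bipartition have equal size. $t(n,H)$ is the Tur\'an number: the maximum number of edges in an $n$-vertex graph not containing $H$ as a subgraph. For a graph $G$ with degree sequence $d_1,\ldots,d_n$, $e_p(G)=\sum_{i=1}^n d_i^p$, and $t_p(n,H)$ is the maximum of $e_p(G)$ over all $n$-vertex graphs not containing $H$ as a subgraph. -}

module Defs where

open import Data.Nat using (ℕ; zero; suc; _+_; _*_; _^_; _<ᵇ_)
open import Data.Bool using (Bool; true; false; if_then_else_; _∧_)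
open import Data.Fin using (Fin; zero; suc; toℕ; inject₁; fromℕ)
open import Data.Product using (Σ; _×_; ∃)
open import Relation.Binary.PropositionalEquality using (_≡_)
open import Relation.Nullary using (¬_)
open import Function.Definitions using (Injective)

record Graph (n : ℕ) : Set where
  field
    adj   : Fin n → Fin n → Bool
    sym   : ∀ i j → adj i j ≡ adj j i
    irrefl : ∀ i → adj i i ≡ false
open Graph public

sumF : ∀ {n} → (Fin n → ℕ) → ℕ
sumF {zero}  f = 0
sumF {suc n} f = f zero + sumF (λ i → f (suc i))

count : ∀ {n} → (Fin n → Bool) → ℕ
count f = sumF (λ i → if f i then 1 else 0)

degree : ∀ {n} → Graph n → Fin n → ℕ
degree G i = count (adj G i)

edges : ∀ {n} → Graph n → ℕ
edges G = sumF (λ i → count (λ j → (toℕ i <ᵇ toℕ j) ∧ adj G i j))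

ep : ℕ → ∀ {n} → Graph n → ℕ
ep p G = sumF (λ i → degree G i ^ p)

Contains : ∀ {m n} → Graph m → Graph n → Set
Contains {m} {n} H G =
  Σ (Fin m → Fin n) λ f → Injective _≡_ _≡_ f ×
    (∀ i j → adj H i j ≡ true → adj G (f i) (f j) ≡ true)

data Walk {n} (G : Graph n) : Fin n → Fin n → Set where
  here : ∀ {i} → Walk G i i
  step : ∀ {i j l} → adj G i j ≡ true → Walk G j l → Walk G i l

Connected : ∀ {n} → Graph n → Set
Connected {n} G = ∀ (i j : Fin n) → Walk G i j

HasCycle : ∀ {n} → Graph n → Set
HasCycle {n} G = ∃ λ (l : ℕ) → Σ (Fin (3 + l) → Fin n) λ c →
  Injective _≡_ _≡_ c ×
  (∀ (i : Fin (2 + l)) → adj G (c (inject₁ i)) (c (suc i)) ≡ true) ×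
  adj G (c (fromℕ (2 + l))) (c zero) ≡ true

IsTree : ∀ {n} → Graph n → Set
IsTree G = Connected G × ¬ HasCycle G

-- connected bipartite graph whose two colour classes have equal size
-- (for a connected graph the bipartition is unique up to swapping)
Equipartite : ∀ {n} → Graph n → Set
Equipartite {n} G = Connected G ×
  Σ (Fin n → Bool) λ col →
    (∀ i j → adj G i j ≡ true → ¬ (col i ≡ col j)) ×
    count col ≡ count (λ i → if col i then false else true)

-- Write K = k − 1. For the lower bound, H does not embed in the complete bipartite graph
-- K_{K,n−K}: along the connected H, the side of the image and the colour of a vertex flip
-- together, so one colour class of H, of size K + 1, would land in the side of size K. That
-- graph has e_p ≥ K (n − K)^p = K n^p − O(n^(p−1)).
-- For the upper bound, call a vertex heavy if its degree is at least n/c. As e(G) ≤ K n there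
-- are at most 2Kc heavy vertices, and as the bipartite graph between heavy and light vertices is
-- again H-free, the heavy degrees sum to at most K n + (2Kc)². Hence heavy vertices contribute
-- at most n^(p−1) (K n + (2Kc)²) to e_p and light ones at most n^(p−1) · 2Kn / c; with
-- c > 2Km this is at most K n^p + n^p / m once n is large.

module Submission where

open import Defs hiding (sym)
open import Data.Bool using (Bool; true; false; not; _∧_; _xor_; if_then_else_)
open import Data.Bool.Properties using (not-involutive; ¬-not; xor-comm; xor-same; xor-assoc; xor-identityʳ)
open import Data.Fin using (Fin; zero; suc; toℕ; punchIn; punchOut)
open import Data.Fin.Properties using (suc-injective; toℕ-injective; punchIn-punchOut; punchOut-injective)
open import Data.Nat using (ℕ; zero; suc; _+_; _*_; _^_; _∸_; _≤_; _<_; z≤n; s≤s; _<ᵇ_; _≤ᵇ_; >-nonZero)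
open import Data.Nat.Properties hiding (suc-injective)
open import Data.Nat.Tactic.RingSolver using (solve-∀)
open import Data.Product using (Σ; _×_; ∃; _,_)
open import Function using (_∘_)
open import Function.Definitions using (Injective)
open import Relation.Nullary using (¬_; contradiction; ofʸ; ofⁿ)
open import Relation.Binary.PropositionalEquality
open import Algebra.Properties.CommutativeSemigroup +-commutativeSemigroup using (interchange)

⟦_⟧ : Bool → ℕ
⟦ b ⟧ = if b then 1 else 0

⟦⟧≤1 : ∀ b → ⟦ b ⟧ ≤ 1
⟦⟧≤1 true  = ≤-refl
⟦⟧≤1 false = z≤n

sumF-cong : ∀ {n} {f g : Fin n → ℕ} → (∀ i → f i ≡ g i) → sumF f ≡ sumF g
sumF-cong {zero}  f≗g = refl
sumF-cong {suc n} f≗g = cong₂ _+_ (f≗g zero) (sumF-cong (f≗g ∘ suc))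

sumF-mono-≤ : ∀ {n} {f g : Fin n → ℕ} → (∀ i → f i ≤ g i) → sumF f ≤ sumF g
sumF-mono-≤ {zero}  f≤g = z≤n
sumF-mono-≤ {suc n} f≤g = +-mono-≤ (f≤g zero) (sumF-mono-≤ (f≤g ∘ suc))

sumF-distrib-+ : ∀ {n} (f g : Fin n → ℕ) → sumF (λ i → f i + g i) ≡ sumF f + sumF g
sumF-distrib-+ {zero}  f g = refl
sumF-distrib-+ {suc n} f g =
  trans (cong (f zero + g zero +_) (sumF-distrib-+ (f ∘ suc) (g ∘ suc)))
        (interchange (f zero) (g zero) (sumF (f ∘ suc)) (sumF (g ∘ suc)))

*-distribˡ-sumF : ∀ {n} c (f : Fin n → ℕ) → c * sumF f ≡ sumF (λ i → c * f i)
*-distribˡ-sumF {zero}  c f = *-zeroʳ c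
*-distribˡ-sumF {suc n} c f =
  trans (*-distribˡ-+ c (f zero) _) (cong (c * f zero +_) (*-distribˡ-sumF c (f ∘ suc)))

sumF-const : ∀ {n} c → sumF {n} (λ _ → c) ≡ n * c
sumF-const {zero}  c = refl
sumF-const {suc n} c = cong (c +_) (sumF-const {n} c)

sumF-comm : ∀ {m n} (f : Fin m → Fin n → ℕ) →
  sumF (λ i → sumF (f i)) ≡ sumF (λ j → sumF (λ i → f i j))
sumF-comm {zero}  {n} f = sym (trans (sumF-const {n} 0) (*-zeroʳ n))
sumF-comm {suc m} {n} f =
  trans (cong (sumF (f zero) +_) (sumF-comm (f ∘ suc)))
        (sym (sumF-distrib-+ (f zero) (λ j → sumF (λ i → f (suc i) j))))

sumF-punchIn : ∀ {n} (f : Fin (suc n) → ℕ) i → sumF f ≡ f i + sumF (f ∘ punchIn i)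
sumF-punchIn f zero = refl
sumF-punchIn {suc n} f (suc i) = begin
  f zero + sumF (f ∘ suc)                           ≡⟨ cong (f zero +_) (sumF-punchIn (f ∘ suc) i) ⟩
  f zero + (f (suc i) + sumF (f ∘ suc ∘ punchIn i)) ≡⟨ x+[y+z]≡y+[x+z] (f zero) (f (suc i)) _ ⟩
  f (suc i) + (f zero + sumF (f ∘ suc ∘ punchIn i)) ∎
  where
  open ≡-Reasoning
  x+[y+z]≡y+[x+z] : ∀ x y z → x + (y + z) ≡ y + (x + z)
  x+[y+z]≡y+[x+z] = solve-∀

sumF-∘-injective-≤ : ∀ {m n} (g : Fin n → ℕ) {f : Fin m → Fin n} → Injective _≡_ _≡_ f →
  sumF (g ∘ f) ≤ sumF g
sumF-∘-injective-≤ {zero} g f-inj = z≤n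
sumF-∘-injective-≤ {suc m} {zero} g {f} f-inj with f zero
... | ()
sumF-∘-injective-≤ {suc m} {suc n} g {f} f-inj = begin
  g f₀ + sumF (g ∘ f ∘ suc)              ≡⟨ cong (g f₀ +_) (sumF-cong (cong g ∘ sym ∘ punchIn-punchOut ∘ f₀≢f∘suc)) ⟩
  g f₀ + sumF (g ∘ punchIn f₀ ∘ f′)      ≤⟨ +-monoʳ-≤ (g f₀) (sumF-∘-injective-≤ (g ∘ punchIn f₀) f′-inj) ⟩
  g f₀ + sumF (g ∘ punchIn f₀)           ≡⟨ sumF-punchIn g f₀ ⟨
  sumF g                                 ∎
  where
  open ≤-Reasoning
  f₀ = f zero
  f₀≢f∘suc : ∀ a → f₀ ≢ f (suc a)
  f₀≢f∘suc a eq with f-inj eq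
  ... | ()
  f′ : Fin m → Fin n
  f′ a = punchOut (f₀≢f∘suc a)
  f′-inj : Injective _≡_ _≡_ f′
  f′-inj {a} {b} eq = suc-injective (f-inj (punchOut-injective (f₀≢f∘suc a) (f₀≢f∘suc b) eq))

count≤n : ∀ {n} (f : Fin n → Bool) → count f ≤ n
count≤n {n} f = ≤-trans (sumF-mono-≤ (⟦⟧≤1 ∘ f)) (≤-reflexive (trans (sumF-const {n} 1) (*-identityʳ n)))

count+count-not : ∀ {n} (f : Fin n → Bool) → count f + count (not ∘ f) ≡ n
count+count-not {n} f = begin
  count f + count (not ∘ f)              ≡⟨ sumF-distrib-+ (⟦_⟧ ∘ f) (⟦_⟧ ∘ not ∘ f) ⟨
  sumF (λ i → ⟦ f i ⟧ + ⟦ not (f i) ⟧)   ≡⟨ sumF-cong (⟦⟧+⟦not⟧≡1 ∘ f) ⟩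
  sumF {n} (λ _ → 1)                     ≡⟨ trans (sumF-const {n} 1) (*-identityʳ n) ⟩
  n                                      ∎
  where
  open ≡-Reasoning
  ⟦⟧+⟦not⟧≡1 : ∀ b → ⟦ b ⟧ + ⟦ not b ⟧ ≡ 1
  ⟦⟧+⟦not⟧≡1 true  = refl
  ⟦⟧+⟦not⟧≡1 false = refl

count-<ᵇ : ∀ {n K} → K ≤ n → count {n} (λ j → toℕ j <ᵇ K) ≡ K
count-<ᵇ {n} {zero} _ = trans (sumF-const {n} 0) (*-zeroʳ n)
count-<ᵇ {suc n} {suc K} (s≤s K≤n) = cong suc (count-<ᵇ K≤n)

sumF-degree-split : ∀ {n} (G : Graph n) (P : Fin n → Fin n → ℕ) →
  (∀ i j → ⟦ adj G i j ⟧ ≡ P i j + P j i) → sumF (degree G) ≡ 2 * sumF (λ i → sumF (P i))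
sumF-degree-split G P split = begin
  sumF (λ i → sumF (λ j → ⟦ adj G i j ⟧))           ≡⟨ sumF-cong (λ i → sumF-cong (split i)) ⟩
  sumF (λ i → sumF (λ j → P i j + P j i))           ≡⟨ sumF-cong (λ i → sumF-distrib-+ (P i) (λ j → P j i)) ⟩
  sumF (λ i → sumF (P i) + sumF (λ j → P j i))      ≡⟨ sumF-distrib-+ (λ i → sumF (P i)) _ ⟩
  ΣP + sumF (λ i → sumF (λ j → P j i))              ≡⟨ cong (ΣP +_) (sumF-comm P) ⟨
  ΣP + ΣP                                           ≡⟨ cong (ΣP +_) (+-identityʳ ΣP) ⟨
  2 * ΣP                                            ∎
  where
  open ≡-Reasoning
  ΣP = sumF (λ i → sumF (P i))

handshake : ∀ {n} (G : Graph n) → sumF (degree G) ≡ 2 * edges G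
handshake G = sumF-degree-split G (λ i j → ⟦ (toℕ i <ᵇ toℕ j) ∧ adj G i j ⟧) split
  where
  split : ∀ i j → ⟦ adj G i j ⟧ ≡ ⟦ (toℕ i <ᵇ toℕ j) ∧ adj G i j ⟧ + ⟦ (toℕ j <ᵇ toℕ i) ∧ adj G j i ⟧
  split i j with toℕ i <ᵇ toℕ j | <ᵇ-reflects-< (toℕ i) (toℕ j)
               | toℕ j <ᵇ toℕ i | <ᵇ-reflects-< (toℕ j) (toℕ i)
  ... | true  | ofʸ i<j | true  | ofʸ j<i = contradiction j<i (<-asym i<j)
  ... | true  | _       | false | _       = sym (+-identityʳ _)
  ... | false | _       | true  | _       = cong ⟦_⟧ (Graph.sym G i j)
  ... | false | ofⁿ i≮j | false | ofⁿ j≮i =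
    cong ⟦_⟧ (trans (cong (adj G i) (sym i≡j)) (irrefl G i))
    where
    i≡j : i ≡ j
    i≡j = toℕ-injective (≤-antisym (≮⇒≥ j≮i) (≮⇒≥ i≮j))

_⊆_ : ∀ {n} → Graph n → Graph n → Set
G′ ⊆ G = ∀ i j → adj G′ i j ≡ true → adj G i j ≡ true

Contains-⊆ : ∀ {m n} {H : Graph m} {G′ G : Graph n} → G′ ⊆ G → Contains H G′ → Contains H G
Contains-⊆ G′⊆G (f , f-inj , f-hom) = f , f-inj , λ i j → G′⊆G (f i) (f j) ∘ f-hom i j

module Cut {n} (G : Graph n) (A : Fin n → Bool) where

  cut : Graph n
  cut = record
    { adj    = λ i j → adj G i j ∧ (A i xor A j)
    ; sym    = λ i j → cong₂ _∧_ (Graph.sym G i j) (xor-comm (A i) (A j))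
    ; irrefl = λ i → cong (_∧ (A i xor A i)) (irrefl G i)
    }

  cut⊆G : cut ⊆ G
  cut⊆G i j with adj G i j
  ... | true  = λ _ → refl
  ... | false = λ ()

  crossing : Fin n → Fin n → ℕ
  crossing i j = ⟦ A i ∧ (adj G i j ∧ not (A j)) ⟧

  edges-cut : edges cut ≡ sumF (λ i → sumF (crossing i))
  edges-cut = *-cancelˡ-≡ _ _ 2 (trans (sym (handshake cut)) (sumF-degree-split cut crossing split))
    where
    split : ∀ i j → ⟦ adj cut i j ⟧ ≡ crossing i j + crossing j i
    split i j rewrite Graph.sym G j i with A i | A j | adj G i j
    ... | true  | true  | true  = refl
    ... | true  | true  | false = refl
    ... | true  | false | true  = refl
    ... | true  | false | false = refl
    ... | false | true  | true  = refl
    ... | false | true  | false = refl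
    ... | false | false | true  = refl
    ... | false | false | false = refl

  sumF-degree-in-A≤ : sumF (λ i → ⟦ A i ⟧ * degree G i) ≤ edges cut + count A * count A
  sumF-degree-in-A≤ = begin
    sumF (λ i → ⟦ A i ⟧ * degree G i)                       ≤⟨ sumF-mono-≤ bound ⟩
    sumF (λ i → sumF (crossing i) + count A * ⟦ A i ⟧)      ≡⟨ sumF-distrib-+ (λ i → sumF (crossing i)) _ ⟩
    sumF (λ i → sumF (crossing i)) + sumF (λ i → count A * ⟦ A i ⟧)
                                                            ≡⟨ cong₂ _+_ edges-cut (*-distribˡ-sumF (count A) (⟦_⟧ ∘ A)) ⟨
    edges cut + count A * count A                           ∎
    where
    open ≤-Reasoning
    edge-in-A≤ : ∀ i j → ⟦ A i ⟧ * ⟦ adj G i j ⟧ ≤ crossing i j + ⟦ A i ⟧ * ⟦ A j ⟧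
    edge-in-A≤ i j with A i | A j | adj G i j
    ... | false | _     | _     = z≤n
    ... | true  | _     | false = z≤n
    ... | true  | true  | true  = ≤-refl
    ... | true  | false | true  = ≤-refl
    bound : ∀ i → ⟦ A i ⟧ * degree G i ≤ sumF (crossing i) + count A * ⟦ A i ⟧
    bound i = begin
      ⟦ A i ⟧ * degree G i                                     ≡⟨ *-distribˡ-sumF ⟦ A i ⟧ (⟦_⟧ ∘ adj G i) ⟩
      sumF (λ j → ⟦ A i ⟧ * ⟦ adj G i j ⟧)                     ≤⟨ sumF-mono-≤ (edge-in-A≤ i) ⟩
      sumF (λ j → crossing i j + ⟦ A i ⟧ * ⟦ A j ⟧)            ≡⟨ sumF-distrib-+ (crossing i) _ ⟩
      sumF (crossing i) + sumF (λ j → ⟦ A i ⟧ * ⟦ A j ⟧)       ≡⟨ cong (sumF (crossing i) +_) (*-distribˡ-sumF ⟦ A i ⟧ (⟦_⟧ ∘ A)) ⟨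
      sumF (crossing i) + ⟦ A i ⟧ * count A                    ≡⟨ cong (sumF (crossing i) +_) (*-comm ⟦ A i ⟧ (count A)) ⟩
      sumF (crossing i) + count A * ⟦ A i ⟧                    ∎

d^[2+r]≤n^[1+r]*d : ∀ {d n} r → d ≤ n → d ^ (2 + r) ≤ n ^ suc r * d
d^[2+r]≤n^[1+r]*d {d} r d≤n = ≤-trans (*-monoʳ-≤ d (^-monoˡ-≤ (suc r) d≤n)) (≤-reflexive (*-comm d _))

c*d^[2+r]≤n^[1+r]*d : ∀ {c d n} r → d ≤ n → c * d ≤ n → c * d ^ (2 + r) ≤ n ^ suc r * d
c*d^[2+r]≤n^[1+r]*d {c} {d} {n} r d≤n cd≤n = begin
  c * (d * (d * d ^ r)) ≡⟨ reassoc c d (d ^ r) ⟩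
  c * d * d ^ r * d     ≤⟨ *-monoˡ-≤ d (*-mono-≤ cd≤n (^-monoˡ-≤ r d≤n)) ⟩
  n * n ^ r * d         ∎
  where
  open ≤-Reasoning
  reassoc : ∀ c d e → c * (d * (d * e)) ≡ c * d * e * d
  reassoc = solve-∀

module HeavyVertices {n} (G : Graph n) (c : ℕ) where

  heavy : Fin n → Bool
  heavy i = n ≤ᵇ c * degree G i

  n*count-heavy≤ : n * count heavy ≤ c * sumF (degree G)
  n*count-heavy≤ = begin
    n * count heavy              ≡⟨ *-distribˡ-sumF n (⟦_⟧ ∘ heavy) ⟩
    sumF (λ i → n * ⟦ heavy i ⟧) ≤⟨ sumF-mono-≤ bound ⟩
    sumF (λ i → c * degree G i)  ≡⟨ *-distribˡ-sumF c (degree G) ⟨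
    c * sumF (degree G)          ∎
    where
    open ≤-Reasoning
    bound : ∀ i → n * ⟦ heavy i ⟧ ≤ c * degree G i
    bound i with heavy i | ≤ᵇ-reflects-≤ n (c * degree G i)
    ... | true  | ofʸ n≤cd = ≤-trans (≤-reflexive (*-identityʳ n)) n≤cd
    ... | false | _        = ≤-trans (≤-reflexive (*-zeroʳ n)) z≤n

  c*ep≤ : ∀ r → let q = n ^ suc r in
    c * ep (2 + r) G ≤ c * (q * sumF (λ i → ⟦ heavy i ⟧ * degree G i)) + q * sumF (degree G)
  c*ep≤ r = begin
    c * ep (2 + r) G                                           ≡⟨ *-distribˡ-sumF c (λ i → degree G i ^ (2 + r)) ⟩
    sumF (λ i → c * degree G i ^ (2 + r))                      ≤⟨ sumF-mono-≤ bound ⟩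
    sumF (λ i → c * (q * (⟦ heavy i ⟧ * degree G i)) + q * degree G i)
                                                               ≡⟨ sumF-distrib-+ (λ i → c * (q * (⟦ heavy i ⟧ * degree G i))) (λ i → q * degree G i) ⟩
    sumF (λ i → c * (q * (⟦ heavy i ⟧ * degree G i))) + sumF (λ i → q * degree G i)
                                                               ≡⟨ cong₂ _+_ pull-constants (*-distribˡ-sumF q (degree G)) ⟨
    c * (q * sumF (λ i → ⟦ heavy i ⟧ * degree G i)) + q * sumF (degree G) ∎
    where
    open ≤-Reasoning
    q = n ^ suc r
    pull-constants : c * (q * sumF (λ i → ⟦ heavy i ⟧ * degree G i)) ≡ sumF (λ i → c * (q * (⟦ heavy i ⟧ * degree G i)))
    pull-constants = trans (cong (c *_) (*-distribˡ-sumF q (λ i → ⟦ heavy i ⟧ * degree G i)))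
                           (*-distribˡ-sumF c (λ i → q * (⟦ heavy i ⟧ * degree G i)))
    bound : ∀ i → c * degree G i ^ (2 + r) ≤ c * (q * (⟦ heavy i ⟧ * degree G i)) + q * degree G i
    bound i with heavy i | ≤ᵇ-reflects-≤ n (c * degree G i)
    ... | true | _ = begin
      c * degree G i ^ (2 + r)          ≤⟨ *-monoʳ-≤ c (d^[2+r]≤n^[1+r]*d r (count≤n (adj G i))) ⟩
      c * (q * degree G i)              ≡⟨ cong (λ x → c * (q * x)) (*-identityˡ (degree G i)) ⟨
      c * (q * (1 * degree G i))        ≤⟨ m≤m+n _ _ ⟩
      c * (q * (1 * degree G i)) + q * degree G i ∎
    ... | false | ofⁿ n≰cd =
      ≤-trans (c*d^[2+r]≤n^[1+r]*d {c} r (count≤n (adj G i)) (<⇒≤ (≰⇒> n≰cd))) (m≤n+m (q * degree G i) (c * (q * 0)))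

absorb-threshold : ∀ {K m n q c E l} → 2 * K * m < c →
  c * E ≤ c * (q * (K * n + l * l)) + q * (2 * (K * n)) → c * m * (l * l) ≤ n →
  m * E ≤ m * (K * (n * q)) + n * q
absorb-threshold {K} {m} {n} {q} {c} {E} {l} 2Km<c cE≤ cml²≤n =
  *-cancelˡ-≤ c {{>-nonZero (≤-trans (s≤s z≤n) 2Km<c)}} (begin
    c * (m * E)                                       ≡⟨ swap c m E ⟩
    m * (c * E)                                       ≤⟨ *-monoʳ-≤ m cE≤ ⟩
    m * (c * (q * (K * n + l * l)) + q * (2 * (K * n))) ≡⟨ expand c K m n q l ⟩
    c * X + ((c * m * (l * l)) * q + 2 * K * m * (n * q)) ≤⟨ +-monoʳ-≤ (c * X) (+-monoˡ-≤ _ (*-monoˡ-≤ q cml²≤n)) ⟩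
    c * X + suc (2 * K * m) * (n * q)                 ≤⟨ +-monoʳ-≤ (c * X) (*-monoˡ-≤ (n * q) 2Km<c) ⟩
    c * X + c * (n * q)                               ≡⟨ *-distribˡ-+ c X (n * q) ⟨
    c * (X + n * q)                                   ∎)
  where
  open ≤-Reasoning
  X = m * (K * (n * q))
  swap : ∀ c m E → c * (m * E) ≡ m * (c * E)
  swap = solve-∀
  expand : ∀ c K m n q l → m * (c * (q * (K * n + l * l)) + q * (2 * (K * n)))
                         ≡ c * (m * (K * (n * q))) + ((c * m * (l * l)) * q + 2 * K * m * (n * q))
  expand = solve-∀

ep≤-of-hereditarily-sparse : ∀ {n} K m r c (G : Graph n) → 1 ≤ n → 2 * K * m < c →
  c * m * ((c * (2 * K)) * (c * (2 * K))) ≤ n → (∀ G′ → G′ ⊆ G → edges G′ ≤ K * n) →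
  m * ep (2 + r) G ≤ m * (K * n ^ (2 + r)) + n ^ (2 + r)
ep≤-of-hereditarily-sparse {n} K m r c G 1≤n 2Km<c n-large sparse =
  absorb-threshold {K} {l = l} 2Km<c c*ep≤′ (≤-trans (*-monoʳ-≤ (c * m) (*-mono-≤ l≤ l≤)) n-large)
  where
  open HeavyVertices G c
  open Cut G heavy
  q = n ^ suc r
  l = count heavy
  sumF-degree≤ : sumF (degree G) ≤ 2 * (K * n)
  sumF-degree≤ = ≤-trans (≤-reflexive (handshake G)) (*-monoʳ-≤ 2 (sparse G (λ _ _ e → e)))
  sumF-heavy-degree≤ : sumF (λ i → ⟦ heavy i ⟧ * degree G i) ≤ K * n + l * l
  sumF-heavy-degree≤ = ≤-trans sumF-degree-in-A≤ (+-monoˡ-≤ (l * l) (sparse cut cut⊆G))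
  l≤ : l ≤ c * (2 * K)
  l≤ = *-cancelˡ-≤ n {{>-nonZero 1≤n}} (begin
    n * l                 ≤⟨ n*count-heavy≤ ⟩
    c * sumF (degree G)   ≤⟨ *-monoʳ-≤ c sumF-degree≤ ⟩
    c * (2 * (K * n))     ≡⟨ rearrange c K n ⟩
    n * (c * (2 * K))     ∎)
    where
    open ≤-Reasoning
    rearrange : ∀ c K n → c * (2 * (K * n)) ≡ n * (c * (2 * K))
    rearrange = solve-∀
  c*ep≤′ : c * ep (2 + r) G ≤ c * (q * (K * n + l * l)) + q * (2 * (K * n))
  c*ep≤′ = ≤-trans (c*ep≤ r)
    (+-mono-≤ (*-monoʳ-≤ c (*-monoʳ-≤ q sumF-heavy-degree≤)) (*-monoʳ-≤ q sumF-degree≤))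

walk-invariant : ∀ {n} {G : Graph n} (g : Fin n → Bool) →
  (∀ a b → adj G a b ≡ true → g a ≡ g b) → ∀ {a b} → Walk G a b → g a ≡ g b
walk-invariant g preserved here         = refl
walk-invariant g preserved (step e w) = trans (preserved _ _ e) (walk-invariant g preserved w)

xor≡true⇒≢ : ∀ {x y} → x xor y ≡ true → x ≢ y
xor≡true⇒≢ {x} e refl with trans (sym (xor-same x)) e
... | ()

xor-cong-≢ : ∀ {x y u v} → x ≢ y → u ≢ v → x xor u ≡ y xor v
xor-cong-≢ {y = y} {v = v} x≢y u≢v rewrite ¬-not x≢y | ¬-not u≢v with y
... | true  = refl
... | false = not-involutive v

xor-cancelʳ : ∀ x y → (x xor y) xor y ≡ x
xor-cancelʳ x y = trans (xor-assoc x y y) (trans (cong (x xor_) (xor-same y)) (xor-identityʳ x))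

balanced-class-size : ∀ {K} (col : Fin (2 * suc K) → Bool) →
  count col ≡ count (λ i → if col i then false else true) → ∀ b → count (λ a → b xor col a) ≡ suc K
balanced-class-size {K} col balanced = class
  where
  balanced′ : count col ≡ count (not ∘ col)
  balanced′ = trans balanced (sumF-cong (λ i → cong ⟦_⟧ (if-not (col i))))
    where
    if-not : ∀ b → (if b then false else true) ≡ not b
    if-not true  = refl
    if-not false = refl
  count-col : count col ≡ suc K
  count-col = *-cancelˡ-≡ _ _ 2 (begin
    2 * count col                    ≡⟨ cong (count col +_) (+-identityʳ (count col)) ⟩
    count col + count col            ≡⟨ cong (count col +_) balanced′ ⟩
    count col + count (not ∘ col)    ≡⟨ count+count-not col ⟩
    2 * suc K                        ∎)
    where open ≡-Reasoning
  class : ∀ b → count (λ a → b xor col a) ≡ suc K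
  class false = count-col
  class true  = trans (sym balanced′) count-col

low : ∀ {n} → ℕ → Fin n → Bool
low K j = toℕ j <ᵇ K

completeBipartite : ℕ → (n : ℕ) → Graph n
completeBipartite K n = record
  { adj    = λ i j → low K i xor low K j
  ; sym    = λ i j → xor-comm (low K i) (low K j)
  ; irrefl = λ i → xor-same (low K i)
  }

completeBipartite-free : ∀ {K n} (H : Graph (2 * suc K)) → Equipartite H → K ≤ n →
  ¬ Contains H (completeBipartite K n)
completeBipartite-free {K} {n} H (connected , col , proper , balanced) K≤n (f , f-inj , f-hom) =
  <-irrefl refl (begin-strict
    K                            <⟨ n<1+n K ⟩
    suc K                        ≡⟨ balanced-class-size col balanced b ⟨
    count (λ a → b xor col a)    ≡⟨ sumF-cong (cong ⟦_⟧ ∘ side≡) ⟨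
    count (low K ∘ f)            ≤⟨ sumF-∘-injective-≤ (⟦_⟧ ∘ low K) f-inj ⟩
    count (low {n} K)            ≡⟨ count-<ᵇ K≤n ⟩
    K                            ∎)
  where
  open ≤-Reasoning
  side : Fin (2 * suc K) → Bool
  side a = low K (f a)
  b : Bool
  b = side zero xor col zero
  side≡ : ∀ a → side a ≡ b xor col a
  side≡ a = trans (sym (xor-cancelʳ (side a) (col a))) (cong (_xor col a) invariant)
    where
    invariant : side a xor col a ≡ b
    invariant = walk-invariant (λ a → side a xor col a)
      (λ a a′ e → xor-cong-≢ {side a} {side a′} (xor≡true⇒≢ (f-hom a a′ e)) (proper a a′ e)) (connected a zero)

degree-completeBipartite-low : ∀ {K n} {i : Fin n} → K ≤ n → low K i ≡ true →
  degree (completeBipartite K n) i ≡ n ∸ K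
degree-completeBipartite-low {K} {n} {i} K≤n i-low = begin
  degree (completeBipartite K n) i  ≡⟨ sumF-cong (λ j → cong (λ b → ⟦ b xor L j ⟧) i-low) ⟩
  count (not ∘ L)                   ≡⟨ m+n∸m≡n K _ ⟨
  K + count (not ∘ L) ∸ K           ≡⟨ cong (λ x → x + count (not ∘ L) ∸ K) (count-<ᵇ K≤n) ⟨
  count L + count (not ∘ L) ∸ K     ≡⟨ cong (_∸ K) (count+count-not L) ⟩
  n ∸ K                             ∎
  where
  open ≡-Reasoning
  L = low {n} K

K*[n∸K]^p≤ep-completeBipartite : ∀ {K n} p → K ≤ n → K * (n ∸ K) ^ p ≤ ep p (completeBipartite K n)
K*[n∸K]^p≤ep-completeBipartite {K} {n} p K≤n = begin
  K * e                           ≡⟨ cong (_* e) (count-<ᵇ K≤n) ⟨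
  count (low {n} K) * e           ≡⟨ *-comm (count (low {n} K)) e ⟩
  e * count (low {n} K)           ≡⟨ *-distribˡ-sumF e (⟦_⟧ ∘ low {n} K) ⟩
  sumF {n} (λ i → e * ⟦ low K i ⟧) ≤⟨ sumF-mono-≤ bound ⟩
  ep p (completeBipartite K n)    ∎
  where
  open ≤-Reasoning
  e = (n ∸ K) ^ p
  bound-at : ∀ i {b} → low K i ≡ b → e * ⟦ b ⟧ ≤ degree (completeBipartite K n) i ^ p
  bound-at i {false} _     = ≤-trans (≤-reflexive (*-zeroʳ e)) z≤n
  bound-at i {true}  i-low =
    ≤-reflexive (trans (*-identityʳ e) (cong (_^ p) (sym (degree-completeBipartite-low K≤n i-low))))
  bound : ∀ i → e * ⟦ low K i ⟧ ≤ degree (completeBipartite K n) i ^ p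
  bound i = bound-at i refl

[m+n]^[1+q]≤m^[1+q]+[1+q]*[n*[m+n]^q] : ∀ m n q → (m + n) ^ suc q ≤ m ^ suc q + suc q * (n * (m + n) ^ q)
[m+n]^[1+q]≤m^[1+q]+[1+q]*[n*[m+n]^q] m n zero = ≤-reflexive (base m n)
  where
  base : ∀ m n → (m + n) * 1 ≡ m * 1 + 1 * (n * 1)
  base = solve-∀
[m+n]^[1+q]≤m^[1+q]+[1+q]*[n*[m+n]^q] m n (suc q) = begin
  (m + n) * (m + n) ^ suc q                         ≤⟨ *-monoʳ-≤ (m + n) ([m+n]^[1+q]≤m^[1+q]+[1+q]*[n*[m+n]^q] m n q) ⟩
  (m + n) * (a + suc q * (n * b))                   ≡⟨ expand m n a b (suc q) ⟩
  m * a + n * a + suc q * (n * ((m + n) * b))       ≤⟨ +-monoˡ-≤ _ (+-monoʳ-≤ (m * a) (*-monoʳ-≤ n (^-monoˡ-≤ (suc q) (m≤m+n m n)))) ⟩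
  m * a + n * (m + n) ^ suc q + suc q * (n * (m + n) ^ suc q) ≡⟨ collect (m * a) n ((m + n) ^ suc q) (suc q) ⟩
  m * a + suc (suc q) * (n * (m + n) ^ suc q)       ∎
  where
  open ≤-Reasoning
  a = m ^ suc q
  b = (m + n) ^ q
  expand : ∀ m n a b r → (m + n) * (a + r * (n * b)) ≡ m * a + n * a + r * (n * ((m + n) * b))
  expand = solve-∀
  collect : ∀ x n c r → x + n * c + r * (n * c) ≡ x + (1 + r) * (n * c)
  collect = solve-∀

m*K*n^p≤m*ep-completeBipartite+n^p : ∀ m K q {n} → K ≤ n → m * K * suc q * K ≤ n →
  m * (K * n ^ suc q) ≤ m * ep (suc q) (completeBipartite K n) + n ^ suc q
m*K*n^p≤m*ep-completeBipartite+n^p m K q {n} K≤n n-large = begin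
  m * (K * n ^ suc q)                                  ≡⟨ cong (λ y → m * (K * y ^ suc q)) x+K≡n ⟨
  m * (K * (x + K) ^ suc q)                            ≤⟨ *-monoʳ-≤ m (*-monoʳ-≤ K ([m+n]^[1+q]≤m^[1+q]+[1+q]*[n*[m+n]^q] x K q)) ⟩
  m * (K * (x ^ suc q + suc q * (K * (x + K) ^ q)))    ≡⟨ expand m K (x ^ suc q) (suc q) ((x + K) ^ q) ⟩
  m * (K * x ^ suc q) + m * K * suc q * K * (x + K) ^ q ≡⟨ cong (λ y → m * (K * x ^ suc q) + m * K * suc q * K * y ^ q) x+K≡n ⟩
  m * (K * x ^ suc q) + m * K * suc q * K * n ^ q      ≤⟨ +-mono-≤ (*-monoʳ-≤ m (K*[n∸K]^p≤ep-completeBipartite (suc q) K≤n)) (*-monoˡ-≤ (n ^ q) n-large) ⟩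
  m * ep (suc q) (completeBipartite K n) + n ^ suc q   ∎
  where
  open ≤-Reasoning
  x = n ∸ K
  x+K≡n : x + K ≡ n
  x+K≡n = m∸n+n≡m K≤n
  expand : ∀ m K a p b → m * (K * (a + p * (K * b))) ≡ m * (K * a) + m * K * p * K * b
  expand = solve-∀

proposition4p4 : (k p : ℕ) (H : Graph (2 * k)) → 1 ≤ k → 2 ≤ p →
    IsTree H → Equipartite H →
    (∀ (n : ℕ) (G : Graph n) → ¬ Contains H G → edges G ≤ (k ∸ 1) * n) →
    ∀ (m : ℕ) → 1 ≤ m → ∃ λ (N : ℕ) → ∀ (n : ℕ) → N ≤ n →
      ((∀ (G : Graph n) → ¬ Contains H G →
          m * ep p G ≤ m * ((k ∸ 1) * n ^ p) + n ^ p) ×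
       Σ (Graph n) λ G → ¬ Contains H G ×
          m * ((k ∸ 1) * n ^ p) ≤ m * ep p G + n ^ p)
proposition4p4 (suc K) (suc (suc r)) H (s≤s z≤n) (s≤s (s≤s z≤n)) _ equipartite turán m _ =
  suc (A + B + K) , λ n N≤n →
    (λ G H-free → ep≤-of-hereditarily-sparse K m r c G (≤-trans (s≤s z≤n) N≤n) (n<1+n _)
                    (below N≤n (≤-trans (m≤m+n A B) (m≤m+n (A + B) K)))
                    (λ G′ G′⊆G → turán n G′ (H-free ∘ Contains-⊆ {H = H} {G′} {G} G′⊆G))) ,
    completeBipartite K n , completeBipartite-free H equipartite (below N≤n (m≤n+m K (A + B))) ,
    m*K*n^p≤m*ep-completeBipartite+n^p m K (suc r) (below N≤n (m≤n+m K (A + B)))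
      (below N≤n (≤-trans (m≤n+m B A) (m≤m+n (A + B) K)))
  where
  c = suc (2 * K * m)
  A = c * m * ((c * (2 * K)) * (c * (2 * K)))
  B = m * K * suc (suc r) * K
  below : ∀ {n x} → suc (A + B + K) ≤ n → x ≤ A + B + K → x ≤ n
  below N≤n x≤ = ≤-trans (≤-trans x≤ (n≤1+n _)) N≤n
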